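{- Let $\approx$ be an equivalence relation on the family of point sets over $\mathbb N$ satisfying (E1) and (E2) below. Then for all finite point sets $A,B$: $A\approx B$ if and only if $|A|=|B|$. (E1) $A\approx B$ iff $A\setminus B\approx B\setminus A$, for all point sets $A,B$. (E2) For all point sets $A,B$ exactly one of the following holds: (a) $A\approx B$; (b) $A'\approx B$ for some proper subset $A'\subset A$; (c) $A\approx B'$ for some proper subset $B'\subset B$.
   Context: $\mathbb N=\{0,1,2,\dots\}$. A point set over $\mathbb N$ is a subset of $\mathbb N^k$ for some $k\ge1$. -}

module Defs where

open import Level using (Level; _⊔_) renaming (suc to lsuc; zero to lzero)
open import Data.Nat using (ℕ; _≤_)
open import Data.List using (List; length)
open import Data.Product using (Σ; ∃; _×_; _,_; proj₁; proj₂)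
open import Data.Sum using (_⊎_)
open import Relation.Nullary using (¬_)
open import Relation.Binary.PropositionalEquality using (_≡_)
open import Relation.Unary using (Pred; _∈_; _∉_; _⊆_; _≐_)
open import Relation.Binary using (IsEquivalence)
open import Function.Bundles using (_⇔_)
import Data.List.Membership.Propositional as L
open import Data.List.Relation.Unary.Unique.Propositional using (Unique)

-- A point is a tuple of naturals; a tuple in ℕ^k is a list of length k.
Point : Set
Point = List ℕ

IsPointSet : Pred Point lzero → Set
IsPointSet S = ∃ λ k → (1 ≤ k) × (∀ x → x ∈ S → length x ≡ k)

record PointSet : Set₁ where
  constructor pointSet
  field
    carrier : Pred Point lzero
    isPointSet : IsPointSet carrier
open PointSet public

_≐ₚ_ : PointSet → PointSet → Set
A ≐ₚ B = carrier A ≐ carrier B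

_⊆ₚ_ : PointSet → PointSet → Set
A ⊆ₚ B = carrier A ⊆ carrier B

_⊂ₚ_ : PointSet → PointSet → Set
A ⊂ₚ B = (A ⊆ₚ B) × ¬ (B ⊆ₚ A)

_∖_ : PointSet → PointSet → PointSet
A ∖ B = pointSet (λ x → x ∈ carrier A × x ∉ carrier B)
  (proj₁ (isPointSet A) , proj₁ (proj₂ (isPointSet A)) ,
   λ x p → proj₂ (proj₂ (isPointSet A)) x (proj₁ p))

HasSize : PointSet → ℕ → Set
HasSize A n = Σ (List Point) λ l →
  Unique l × (length l ≡ n) × (∀ x → (x ∈ carrier A) ⇔ (x L.∈ l))

ExactlyOne : ∀ {a b c} → Set a → Set b → Set c → Set (a ⊔ b ⊔ c)
ExactlyOne P Q R = (P ⊎ Q ⊎ R) × ¬ (P × Q) × ¬ (P × R) × ¬ (Q × R)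

module _ (_≈_ : PointSet → PointSet → Set) where
  -- ≈ is a relation on sets, so it must not distinguish equal sets
  RespectsSetEquality : Set₁
  RespectsSetEquality = ∀ A B → A ≐ₚ B → A ≈ B

  E1 : Set₁
  E1 = ∀ A B → (A ≈ B) ⇔ ((A ∖ B) ≈ (B ∖ A))

  E2 : Set₁
  E2 = ∀ A B → ExactlyOne (A ≈ B)
                          (Σ PointSet λ A' → (A' ⊂ₚ A) × (A' ≈ B))
                          (Σ PointSet λ B' → (B' ⊂ₚ B) × (A ≈ B'))

-- Induct on n to show that any two sets of size n are equivalent.  If A and B have
-- size n but A ≉ B, then by (E2) some proper subset of A (say) is equivalent to B.
-- That subset has some size k < n, and B has a proper subset of size k, which is
-- equivalent to it by induction; so A' ≈ B and A' ≈ B' with B' ⊂ B, against the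
-- exclusivity in (E2).  The same exclusivity shows that sets of different sizes are
-- inequivalent.
module Submission where

open import Defs
open import Level using (0ℓ)
open import Data.Nat using (ℕ; suc; _<_; _<′_; ≤′-refl; ≤′-step)
open import Data.Nat.Properties using (<⇒<′; <-cmp; suc-injective)
open import Data.Nat.Induction using (<-rec)
open import Data.List using (List; _∷_; length; filter)
open import Data.List.Properties using (≡-dec; filter-notAll)
open import Data.List.Membership.DecPropositional (≡-dec Data.Nat._≟_) using (_∈?_)
open import Data.List.Membership.Propositional.Properties using (∈-filter⁺; ∈-filter⁻)
open import Data.List.Relation.Unary.Any using (here; there)
open import Data.List.Relation.Unary.All as All using (All)
open import Data.List.Relation.Unary.All.Properties.Core using (¬All⇒Any¬)
open import Data.List.Relation.Unary.AllPairs using (_∷_)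
open import Data.List.Relation.Unary.Unique.Propositional.Properties using (filter⁺)
import Data.List.Membership.Propositional as L
open import Data.Product using (Σ; ∃; _×_; _,_; proj₁; proj₂)
open import Data.Sum using (inj₁; inj₂)
open import Function.Base using (id)
open import Function.Bundles using (_⇔_; mk⇔; Equivalence)
open import Relation.Binary using (IsEquivalence; Symmetric; tri<; tri≈; tri>)
open import Relation.Binary.PropositionalEquality using (_≡_; refl)
open import Relation.Nullary using (¬_; Dec; yes; no; contradiction)
open import Relation.Nullary.Decidable as Dec using (¬¬-excluded-middle)
open import Relation.Nullary.Negation using (¬¬-Monad)
open import Relation.Unary using (Pred; Decidable; _⊆_)

subPointSet : (B : PointSet) (C : Pred Point 0ℓ) → C ⊆ carrier B → PointSet
subPointSet B C C⊆B = pointSet C (k , 1≤k , λ x c → length≡k x (C⊆B c))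
  where open Σ (isPointSet B) renaming (proj₁ to k)
        open Σ (proj₂ (isPointSet B)) renaming (proj₁ to 1≤k; proj₂ to length≡k)

⊂ₚ-trans : ∀ {A B C} → A ⊂ₚ B → B ⊂ₚ C → A ⊂ₚ C
⊂ₚ-trans (A⊆B , _) (B⊆C , C⊈B) = (λ a → B⊆C (A⊆B a)) , λ C⊆A → C⊈B (λ c → A⊆B (C⊆A c))

∃⊂ₚ-pred-size : ∀ {n} B → HasSize B (suc n) → Σ PointSet λ B' → B' ⊂ₚ B × HasSize B' n
∃⊂ₚ-pred-size B (b ∷ l , b∉l ∷ l-unique , length≡ , enum) =
  subPointSet B (L._∈ l) l⊆B ,
  (l⊆B , λ B⊆l → All.lookup b∉l (B⊆l (Equivalence.from (enum b) (here refl))) refl) ,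
  (l , l-unique , suc-injective length≡ , λ _ → mk⇔ id id)
  where
  l⊆B : (L._∈ l) ⊆ carrier B
  l⊆B x∈l = Equivalence.from (enum _) (there x∈l)

∃⊂ₚ-size′ : ∀ {k n} B → k <′ n → HasSize B n → Σ PointSet λ B' → B' ⊂ₚ B × HasSize B' k
∃⊂ₚ-size′ B ≤′-refl hasSize = ∃⊂ₚ-pred-size B hasSize
∃⊂ₚ-size′ B (≤′-step k<n) hasSize with ∃⊂ₚ-pred-size B hasSize
... | B₁ , B₁⊂B , hasSize₁ with ∃⊂ₚ-size′ B₁ k<n hasSize₁
... | B' , B'⊂B₁ , hasSize' = B' , ⊂ₚ-trans {B'} {B₁} {B} B'⊂B₁ B₁⊂B , hasSize'

∃⊂ₚ-size : ∀ {k n} B → k < n → HasSize B n → Σ PointSet λ B' → B' ⊂ₚ B × HasSize B' k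
∃⊂ₚ-size B k<n = ∃⊂ₚ-size′ B (<⇒<′ k<n)

-- Membership in A' need not be decidable, so its size is only available under double
-- negation, where it can be decided on the finitely many points of A.
⊂ₚ-size< : ∀ {n} A A' → HasSize A n → A' ⊂ₚ A → ¬ ¬ (∃ λ k → k < n × HasSize A' k)
⊂ₚ-size< A A' (l , l-unique , refl , enum) (A'⊆A , A⊈A') noSize =
  ¬¬-decisions λ decisions → noSize (sizeFrom decisions)
  where
  ¬¬-decisions : ¬ ¬ All (λ x → Dec (carrier A' x)) l
  ¬¬-decisions = All.sequenceM 0ℓ ¬¬-Monad (All.tabulate λ _ → ¬¬-excluded-middle)

  sizeFrom : All (λ x → Dec (carrier A' x)) l → ∃ λ k → k < length l × HasSize A' k
  sizeFrom decisions = length (filter Q? l) , filter-notAll Q? l (¬All⇒Any¬ Q? l l⊈Q) ,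
    filter Q? l , filter⁺ Q? l-unique , refl ,
    λ x → mk⇔ (enumerates x) (λ x∈ → proj₂ (proj₂ (∈-filter⁻ Q? {xs = l} x∈)))
    where
    Q : Pred Point 0ℓ
    Q x = x L.∈ l × carrier A' x

    Q? : Decidable Q
    Q? x with x ∈? l
    ... | no x∉l = no λ q → x∉l (proj₁ q)
    ... | yes x∈l = Dec.map′ (x∈l ,_) proj₂ (All.lookup decisions x∈l)

    l⊈Q : ¬ All Q l
    l⊈Q allQ = A⊈A' λ a → proj₂ (All.lookup allQ (Equivalence.to (enum _) a))

    enumerates : ∀ x → carrier A' x → x L.∈ filter Q? l
    enumerates x a' = ∈-filter⁺ Q? x∈l (x∈l , a')
      where x∈l = Equivalence.to (enum x) (A'⊆A a')

module _ {_≈_ : PointSet → PointSet → Set} (e2 : E2 _≈_) where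

  EquivalentAtSize : ℕ → Set₁
  EquivalentAtSize n = ∀ A B → HasSize A n → HasSize B n → A ≈ B

  ≉-larger : ∀ {k n A B} → k < n → EquivalentAtSize k → HasSize A k → HasSize B n → ¬ (A ≈ B)
  ≉-larger {A = A} {B} k<n equivalentAtK hasSizeA hasSizeB A≈B with ∃⊂ₚ-size B k<n hasSizeB | e2 A B
  ... | B' , B'⊂B , hasSizeB' | _ , _ , not-≈-and-≈⊂ʳ , _ =
    not-≈-and-≈⊂ʳ (A≈B , B' , B'⊂B , equivalentAtK A B' hasSizeA hasSizeB')

  equivalentAtSize : Symmetric _≈_ → ∀ n → EquivalentAtSize n
  equivalentAtSize ≈-sym = <-rec EquivalentAtSize step
    where
    step : ∀ n → (∀ {k} → k < n → EquivalentAtSize k) → EquivalentAtSize n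
    step n ih A B hasSizeA hasSizeB with proj₁ (e2 A B)
    ... | inj₁ A≈B = A≈B
    ... | inj₂ (inj₁ (A' , A'⊂A , A'≈B)) = contradiction
      (λ (k , k<n , hasSizeA') → ≉-larger k<n (ih k<n) hasSizeA' hasSizeB A'≈B)
      (⊂ₚ-size< A A' hasSizeA A'⊂A)
    ... | inj₂ (inj₂ (B' , B'⊂B , A≈B')) = contradiction
      (λ (k , k<n , hasSizeB') → ≉-larger k<n (ih k<n) hasSizeB' hasSizeA (≈-sym A≈B'))
      (⊂ₚ-size< B B' hasSizeB B'⊂B)

proposition3p3 : (_≈_ : PointSet → PointSet → Set) →
    IsEquivalence _≈_ → RespectsSetEquality _≈_ → E1 _≈_ → E2 _≈_ →
    ∀ (A B : PointSet) (m n : ℕ) → HasSize A m → HasSize B n →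
    (A ≈ B) ⇔ (m ≡ n)
proposition3p3 _≈_ isEquivalence _ _ e2 A B m n hasSizeA hasSizeB = mk⇔ sameSize equivalent
  where
  open IsEquivalence isEquivalence using (sym)

  sameSize : A ≈ B → m ≡ n
  sameSize A≈B with <-cmp m n
  ... | tri< m<n _ _ =
    contradiction A≈B (≉-larger e2 m<n (equivalentAtSize e2 sym m) hasSizeA hasSizeB)
  ... | tri≈ _ m≡n _ = m≡n
  ... | tri> _ _ n<m =
    contradiction (sym A≈B) (≉-larger e2 n<m (equivalentAtSize e2 sym n) hasSizeB hasSizeA)

  equivalent : m ≡ n → A ≈ B
  equivalent refl = equivalentAtSize e2 sym m A B hasSizeA hasSizeB
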